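{- Let $q=p^h$ with $p$ prime and let $M$ be a multiset of points in $\mathrm{AG}(2,q)$. Let $D,\overline D\subseteq\mathbb F_q\cup\{\infty\}$ be the sets of (slopes of) mod-special and mod-equidistributed directions of $M$. For each $\overline d\in\overline D$ let $r_{\overline d}\in\{0,\dots,p-1\}$ be such that every line with slope $\overline d$ contains $r_{\overline d}$ points of $M$ modulo $p$. Define $$c_M=\sum_{(x,y)\in M}\chi_{[x,y,1]}-\sum_{\overline d\in\overline D} r_{\overline d}\,\chi_{[1,\overline d,0]}.$$ Then for every $d\in\mathbb F_q\cup\{\infty\}$ and $b\in\mathbb F_q$, $c_M(d,-1,b)=\mathrm{pr}_{M,d}(b)$ if $d\in D$, and $c_M(d,-1,b)=0$ otherwise. Consequently $c_M$ is an odd codeword on the $|D|$ lines $X+dY=0$, $d\in D$, which are concurrent at $(0,0,1)$.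
   Context: Affine points $(x,y)\in\mathbb F_q^2$ are identified with projective points $(x,y,1)$ of $\mathrm{PG}(2,q)$. $[a,b,c]$ denotes the line $aX+bY+cZ=0$ of $\mathrm{PG}(2,q)$ and $\chi_\ell$ the function from the points of $\mathrm{PG}(2,q)$ to $\mathbb F_p$ that is $1$ on $\ell$ and $0$ elsewhere; the sum over $M$ counts multiplicities. Convention for $d=\infty$: the point $(\infty,-1,b)$ means $(1,0,b)$, the line $[1,\infty,0]$ means $[0,1,0]$, and "$X+\infty Y=0$" means $Y=0$. In $\mathrm{AG}(2,q)$ a line with slope $d\in\mathbb F_q$ is $Y=dX+b$ and with slope $\infty$ is $X+b=0$. A direction $d$ is mod-equidistributed for $M$ if all lines with slope $d$ contain the same number of points of $M$ (with multiplicity) modulo $p$, and mod-special otherwise. $\mathrm{pr}_{M,d}(b)$ is the number of points of $M$ on the line $Y=dX+b$ (or $X+b=0$ if $d=\infty$) reduced mod $p$. $\mathcal C(2,q)$ is the $\mathbb F_p$-span of the $\chi_\ell$. A codeword $c$ is an odd codeword on $n$ lines if its support (points where $c\ne0$) lies in the union of $n$ lines $\ell_1,\dots,\ell_n$ through a common point $P$ and for no $\ell_i$ is $c$ constant on $\ell_i\setminus\{P\}$. -}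

module Defs where

open import Data.Nat as ℕ using (ℕ; zero; suc)
open import Data.Integer as ℤ using (ℤ; +_)
open import Data.Integer.Divisibility using (_∣_)
open import Data.Fin using (Fin)
open import Data.List using (List; []; _∷_; map; allFin; filter; length)
open import Data.List.Relation.Unary.All using (All)
open import Data.List.Membership.Propositional using (_∈_)
open import Data.List.Relation.Unary.Any using (Any)
open import Data.Maybe using (Maybe; just; nothing)
open import Data.Product using (_×_; _,_; ∃; ∃-syntax; Σ-syntax; proj₁; proj₂)
open import Function.Bundles using (_↔_; Inverse)
open import Relation.Binary.PropositionalEquality using (_≡_)
open import Relation.Binary.Definitions using (DecidableEquality)
open import Relation.Nullary using (¬_; Dec; yes; no)
open import Relation.Nullary.Decidable using (¬?)
open import Algebra.Structures using (IsCommutativeRing)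

record FiniteField : Set₁ where
  infixl 7 _*_
  infixl 6 _+_
  field
    F        : Set
    _+_ _*_  : F → F → F
    -_       : F → F
    0# 1#    : F
    isCommutativeRing : IsCommutativeRing _≡_ _+_ _*_ -_ 0# 1#
    _≟_      : DecidableEquality F
    0≢1      : ¬ (0# ≡ 1#)
    inverse  : ∀ x → ¬ (x ≡ 0#) → ∃[ y ] (x * y ≡ 1#)
    size     : ℕ
    enum     : F ↔ Fin size

  fromℕ : ℕ → F
  fromℕ zero    = 0#
  fromℕ (suc n) = 1# + fromℕ n

  elems : List F
  elems = map (Inverse.from enum) (allFin size)

-- Everything below is relative to a finite field K and a prime p
-- (the characteristic); F_p-values are modelled by integers modulo p.

module WithField (K : FiniteField) (p : ℕ) where
  open FiniteField K

  infix 4 _≈ₚ_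
  _≈ₚ_ : ℤ → ℤ → Set
  a ≈ₚ b = (+ p) ∣ (a ℤ.- b)

  -- triples of F_q: homogeneous coordinates of points and lines of PG(2,q)
  Triple : Set
  Triple = F × F × F

  NonZero3 : Triple → Set
  NonZero3 (x , y , z) = ¬ (x ≡ 0# × y ≡ 0# × z ≡ 0#)

  SameProj : Triple → Triple → Set
  SameProj (x , y , z) (x' , y' , z') =
    ∃[ t ] (¬ (t ≡ 0#) × x' ≡ t * x × y' ≡ t * y × z' ≡ t * z)

  OnLine : Triple → Triple → Set
  OnLine (x , y , z) (a , b , c) = a * x + b * y + c * z ≡ 0#

  χ : Triple → Triple → ℤ
  χ (a , b , c) (x , y , z) with (a * x + b * y + c * z) ≟ 0#
  ... | yes _ = + 1
  ... | no  _ = + 0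

  Fun : Set
  Fun = Triple → ℤ

  sumℤ : List ℤ → ℤ
  sumℤ []       = + 0
  sumℤ (x ∷ xs) = x ℤ.+ sumℤ xs

  -- C(2,q): the F_p-span of the characteristic functions of lines
  -- (a finite F_p-linear combination of χ_ℓ, ℓ ranging over lines)
  InCode : Fun → Set
  InCode c = ∃[ ls ] (All (λ (pr : ℤ × Triple) → NonZero3 (proj₂ pr)) ls
    × (∀ P → NonZero3 P →
        c P ≈ₚ sumℤ (map (λ (pr : ℤ × Triple) → proj₁ pr ℤ.* χ (proj₂ pr) P) ls)))

  ConstantOffP : Fun → Triple → Triple → Set
  ConstantOffP c P ℓ = ∃[ k ] (∀ Q → NonZero3 Q → OnLine Q ℓ → ¬ SameProj P Q → c Q ≈ₚ k)

  OddCodewordOn : Fun → Triple → List Triple → Set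
  OddCodewordOn c P ls =
      InCode c
    × NonZero3 P
    × All (λ ℓ → NonZero3 ℓ × OnLine P ℓ) ls
    × (∀ Q → NonZero3 Q → ¬ (c Q ≈ₚ + 0) → Any (OnLine Q) ls)
    × All (λ ℓ → ¬ ConstantOffP c P ℓ) ls

  -- directions / slopes: F_q ∪ {∞}, with ∞ = nothing
  Dir : Set
  Dir = Maybe F

  allDirs : List Dir
  allDirs = nothing ∷ map just elems

  OnAffLine : Dir → F → F × F → Set
  OnAffLine (just d) b (x , y) = y ≡ d * x + b
  OnAffLine nothing  b (x , y) = x + b ≡ 0#

  onAffLine? : ∀ d b pt → Dec (OnAffLine d b pt)
  onAffLine? (just d) b (x , y) = y ≟ (d * x + b)
  onAffLine? nothing  b (x , y) = (x + b) ≟ 0#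

  Multiset : Set
  Multiset = List (F × F)

  count : Multiset → Dir → F → ℕ
  count M d b = length (filter (onAffLine? d b) M)

  pr : Multiset → Dir → F → ℤ
  pr M d b = + count M d b

  ModEquidistributed : Multiset → Dir → Set
  ModEquidistributed M d = ∀ b b' → pr M d b ≈ₚ pr M d b'

  ModSpecial : Multiset → Dir → Set
  ModSpecial M d = ¬ ModEquidistributed M d

  lineDir : Dir → Triple
  lineDir (just d) = (1# , d , 0#)
  lineDir nothing  = (0# , 1# , 0#)

  ptDir : Dir → F → Triple
  ptDir (just d) b = (d , - 1# , b)
  ptDir nothing  b = (1# , 0# , b)

  cM : (M : Multiset) → ((d : Dir) → Dec (ModEquidistributed M d)) → (Dir → ℕ) → Fun
  cM M eq? r P =
    sumℤ (map (λ (pt : F × F) → χ (proj₁ pt , proj₂ pt , 1#) P) M)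
    ℤ.- sumℤ (map (λ d → term d (eq? d)) allDirs)
    where
    term : (d : Dir) → Dec (ModEquidistributed M d) → ℤ
    term d (yes _) = (+ r d) ℤ.* χ (lineDir d) P
    term d (no _)  = + 0

  specialDirs : (M : Multiset) → ((d : Dir) → Dec (ModEquidistributed M d)) → List Dir
  specialDirs M eq? = filter (λ d → ¬? (eq? d)) allDirs

{-# OPTIONS --safe #-}
-- The point (d, -1, b) lies on the line [x, y, 1] exactly when the affine point (x, y) lies on
-- Y = dX + b, and on no line [1, d′, 0] except [1, d, 0]; hence c_M(d, -1, b) = pr_{M,d}(b) - r_d,
-- the term r_d being present only for d ∈ D̄. As a combination of characteristic functions of
-- lines, c_M is a codeword and is invariant under scaling. Every point other than (0, 0, 1) is
-- a multiple of some (d, -1, b), so the support lies on the lines [1, d, 0] with d ∈ D, on which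
-- c_M takes the non-constant values pr_{M,d}. The origin lies on every [1, d, 0] and on no
-- [x, y, 1]; it matters only when D = ∅, where c_M(0, 0, 1) = -Σ_d r_d. Counting M along the
-- q + 1 lines through the origin and along the q vertical lines gives |M| modulo p both times
-- (as p ∣ q), so Σ_d r_d ≡ |M| ≡ q r_∞ ≡ 0.
module Submission where

open import Defs
open import Data.Nat as ℕ using (ℕ; zero; suc; _<_; _^_)
import Data.Nat.Divisibility as ℕ∣
open import Data.Nat.Primality using (Prime)
open import Data.Integer as ℤ using (ℤ; +_)
import Data.Integer.Properties as ℤP
open import Data.Integer.Solver using (module +-*-Solver)
import Data.Integer.Divisibility.Signed as ℤ∣
open import Data.Fin as Fin using (Fin)
open import Data.List using (List; []; _∷_; map; filter; length; _++_; allFin)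
import Data.List.Properties as ListP
open import Data.List.Membership.Propositional using (_∈_)
import Data.List.Membership.Propositional.Properties as ∈P
open import Data.List.Relation.Unary.All as All using (All; []; _∷_)
import Data.List.Relation.Unary.All.Properties as AllP
open import Data.List.Relation.Unary.Any as Any using (Any; here; there)
import Data.List.Relation.Unary.Any.Properties as AnyP
open import Data.List.Relation.Unary.Unique.Propositional using (Unique; []; _∷_)
import Data.List.Relation.Unary.Unique.Propositional.Properties as UniqueP
open import Data.Maybe using (just; nothing)
import Data.Maybe.Properties as MaybeP
open import Data.Product using (_×_; _,_; proj₁; proj₂; ∃; ∃₂)
open import Data.Sum using (_⊎_; inj₁; inj₂)
open import Relation.Nullary using (¬_; Dec; yes; no; contradiction)
open import Relation.Nullary.Decidable using (decidable-stable; ¬?)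
open import Relation.Binary.PropositionalEquality
open import Relation.Binary.Bundles using (Setoid)
open import Relation.Binary.Structures using (IsEquivalence)
import Relation.Binary.Reasoning.Setoid as SetoidReasoning
open import Function using (_∘_; id; case_of_)
open import Function.Bundles using (_⇔_; mk⇔; Equivalence; Inverse)
open import Function.Construct.Composition using (_⇔-∘_)
open import Algebra.Bundles using (CommutativeRing)
import Algebra.Properties.Ring as RingProperties
import Algebra.Properties.Group as GroupProperties

⇔-both-true : ∀ {A B : Set} → A → B → A ⇔ B
⇔-both-true a b = mk⇔ (λ _ → b) (λ _ → a)

⇔-both-false : ∀ {A B : Set} → ¬ A → ¬ B → A ⇔ B
⇔-both-false ¬a ¬b = mk⇔ (λ a → contradiction a ¬a) (λ b → contradiction b ¬b)

module FieldProperties (K : FiniteField) where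
  open FiniteField K
  open Inverse enum using (to; from; strictlyInverseˡ; strictlyInverseʳ)

  commutativeRing : CommutativeRing _ _
  commutativeRing = record { isCommutativeRing = isCommutativeRing }

  open CommutativeRing commutativeRing public using (+-identityʳ; *-identityʳ; zeroʳ)
  open CommutativeRing commutativeRing using (ring; +-group; -‿inverseʳ; *-assoc; *-comm; *-identityˡ)
  open RingProperties ring using (-‿distribʳ-*)
  open GroupProperties +-group using (inverseʳ-unique; x∙y⁻¹≈ε⇒x≈y; x≈y⇒x∙y⁻¹≈ε; ε⁻¹≈ε)
  open GroupProperties +-group public using () renaming (⁻¹-involutive to -‿involutive)

  x*-1≡-x : ∀ x → x * - 1# ≡ - x
  x*-1≡-x x = trans (sym (-‿distribʳ-* x 1#)) (cong -_ (*-identityʳ x))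

  x≢0⇒-x≢0 : ∀ {x} → x ≢ 0# → - x ≢ 0#
  x≢0⇒-x≢0 {x} x≢0 -x≡0 = x≢0 (trans (sym (-‿involutive x)) (trans (cong -_ -x≡0) ε⁻¹≈ε))

  1≢0 : 1# ≢ 0#
  1≢0 = 0≢1 ∘ sym

  x-y≡0⇔x≡y : ∀ x y → x + - y ≡ 0# ⇔ x ≡ y
  x-y≡0⇔x≡y x y = mk⇔ (x∙y⁻¹≈ε⇒x≈y x y) x≈y⇒x∙y⁻¹≈ε

  x*[x⁻¹*y]≡y : ∀ {x x⁻¹} → x * x⁻¹ ≡ 1# → ∀ y → x * (x⁻¹ * y) ≡ y
  x*[x⁻¹*y]≡y {x} {x⁻¹} x*x⁻¹≡1 y = begin
    x * (x⁻¹ * y)  ≡⟨ *-assoc x x⁻¹ y ⟨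
    x * x⁻¹ * y    ≡⟨ cong (_* y) x*x⁻¹≡1 ⟩
    1# * y         ≡⟨ *-identityˡ y ⟩
    y              ∎
    where open ≡-Reasoning

  x*y≡0⇒y≡0 : ∀ {x y} → x ≢ 0# → x * y ≡ 0# → y ≡ 0#
  x*y≡0⇒y≡0 {x} {y} x≢0 x*y≡0 with inverse x x≢0
  ... | x⁻¹ , x*x⁻¹≡1 = begin
    y              ≡⟨ x*[x⁻¹*y]≡y (trans (*-comm x⁻¹ x) x*x⁻¹≡1) y ⟨
    x⁻¹ * (x * y)  ≡⟨ cong (x⁻¹ *_) x*y≡0 ⟩
    x⁻¹ * 0#       ≡⟨ zeroʳ x⁻¹ ⟩
    0#             ∎
    where open ≡-Reasoning

  x+y≡0⇔y≡-x : ∀ x y → x + y ≡ 0# ⇔ y ≡ - x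
  x+y≡0⇔y≡-x x y = mk⇔ (inverseʳ-unique x y) (λ y≡-x → trans (cong (_+_ x) y≡-x) (-‿inverseʳ x))

  y≡e*x⇔e≡y*x⁻¹ : ∀ {x x⁻¹} → x * x⁻¹ ≡ 1# → ∀ y e → y ≡ e * x ⇔ e ≡ y * x⁻¹
  y≡e*x⇔e≡y*x⁻¹ {x} {x⁻¹} x*x⁻¹≡1 y e = mk⇔
    (λ y≡ex → sym (begin
      y * x⁻¹        ≡⟨ cong (_* x⁻¹) y≡ex ⟩
      e * x * x⁻¹    ≡⟨ *-assoc e x x⁻¹ ⟩
      e * (x * x⁻¹)  ≡⟨ cong (e *_) x*x⁻¹≡1 ⟩
      e * 1#         ≡⟨ *-identityʳ e ⟩
      e              ∎))
    (λ e≡yx⁻¹ → sym (begin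
      e * x            ≡⟨ cong (_* x) e≡yx⁻¹ ⟩
      y * x⁻¹ * x      ≡⟨ *-comm (y * x⁻¹) x ⟩
      x * (y * x⁻¹)    ≡⟨ cong (x *_) (*-comm y x⁻¹) ⟩
      x * (x⁻¹ * y)    ≡⟨ x*[x⁻¹*y]≡y x*x⁻¹≡1 y ⟩
      y                ∎))
    where open ≡-Reasoning

  elems-unique : Unique elems
  elems-unique = UniqueP.map⁺ from-injective (UniqueP.allFin⁺ size)
    where
    from-injective : ∀ {i j} → from i ≡ from j → i ≡ j
    from-injective {i} {j} eq = trans (sym (strictlyInverseˡ i)) (trans (cong to eq) (strictlyInverseˡ j))

  ∈-elems : ∀ x → x ∈ elems
  ∈-elems x = subst (_∈ elems) (strictlyInverseʳ x) (∈P.∈-map⁺ from (∈P.∈-allFin (to x)))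

  length-elems : length elems ≡ size
  length-elems = trans (ListP.length-map from (allFin size)) (ListP.length-tabulate id)

  size≢1 : size ≢ 1
  size≢1 size≡1 = 0≢1 (begin
    0#            ≡⟨ strictlyInverseʳ 0# ⟨
    from (to 0#)  ≡⟨ cong from (subst-injective {P = Fin} size≡1 (Fin1-irrelevant _ _)) ⟩
    from (to 1#)  ≡⟨ strictlyInverseʳ 1# ⟩
    1#            ∎)
    where
    open ≡-Reasoning
    Fin1-irrelevant : (i j : Fin 1) → i ≡ j
    Fin1-irrelevant Fin.zero Fin.zero = refl

  size≡p^h⇒p∣size : ∀ p h → size ≡ p ℕ.^ h → p ℕ∣.∣ size
  size≡p^h⇒p∣size p zero    size≡1   = contradiction size≡1 size≢1
  size≡p^h⇒p∣size p (suc h) size≡p^h = subst (p ℕ∣.∣_) (sym size≡p^h) (ℕ∣.m∣m*n (p ℕ.^ h))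

-- sumℤ and _≈ₚ_ are defined inside WithField K p, hence the parameters of the next two modules.
module IntegerSums (K : FiniteField) (p : ℕ) where
  open WithField K p using (sumℤ)
  open import Data.Integer using (_+_; -_; _*_; _-_)
  open +-*-Solver

  private
    variable
      A B : Set

  sumℤ-map-+ : (f g : A → ℤ) (xs : List A) →
               sumℤ (map (λ x → f x + g x) xs) ≡ sumℤ (map f xs) + sumℤ (map g xs)
  sumℤ-map-+ f g []       = refl
  sumℤ-map-+ f g (x ∷ xs) = begin
    f x + g x + sumℤ (map (λ x → f x + g x) xs)        ≡⟨ cong (_+_ (f x + g x)) (sumℤ-map-+ f g xs) ⟩
    f x + g x + (sumℤ (map f xs) + sumℤ (map g xs))    ≡⟨ interchange (f x) (g x) _ _ ⟩
    f x + sumℤ (map f xs) + (g x + sumℤ (map g xs))    ∎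
    where
    open ≡-Reasoning
    interchange : ∀ a b c d → a + b + (c + d) ≡ a + c + (b + d)
    interchange = solve 4 (λ a b c d → a :+ b :+ (c :+ d) := a :+ c :+ (b :+ d)) refl

  sumℤ-map-neg : (f : A → ℤ) (xs : List A) → sumℤ (map (λ x → - f x) xs) ≡ - sumℤ (map f xs)
  sumℤ-map-neg f []       = refl
  sumℤ-map-neg f (x ∷ xs) =
    trans (cong (_+_ (- f x)) (sumℤ-map-neg f xs)) (sym (ℤP.neg-distrib-+ (f x) _))

  sumℤ-++ : (xs ys : List ℤ) → sumℤ (xs ++ ys) ≡ sumℤ xs + sumℤ ys
  sumℤ-++ []       ys = sym (ℤP.+-identityˡ _)
  sumℤ-++ (x ∷ xs) ys = trans (cong (_+_ x) (sumℤ-++ xs ys)) (sym (ℤP.+-assoc x _ _))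

  sumℤ-map-const : (c : ℤ) (xs : List A) → sumℤ (map (λ _ → c) xs) ≡ + length xs * c
  sumℤ-map-const c []       = sym (ℤP.*-zeroˡ c)
  sumℤ-map-const c (x ∷ xs) = begin
    c + sumℤ (map (λ _ → c) xs)  ≡⟨ cong (_+_ c) (sumℤ-map-const c xs) ⟩
    c + + length xs * c          ≡⟨ cong (_+ + length xs * c) (ℤP.*-identityˡ c) ⟨
    + 1 * c + + length xs * c    ≡⟨ ℤP.*-distribʳ-+ c (+ 1) (+ length xs) ⟨
    + length (x ∷ xs) * c        ∎
    where open ≡-Reasoning

  sumℤ-map-zero : (f : A → ℤ) {xs : List A} → All (λ x → f x ≡ + 0) xs → sumℤ (map f xs) ≡ + 0
  sumℤ-map-zero f []         = refl
  sumℤ-map-zero f (fx≡0 ∷ h) = cong₂ _+_ fx≡0 (sumℤ-map-zero f h)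

  sumℤ-map-single : (f : A → ℤ) {xs : List A} {e : A} → Unique xs → e ∈ xs →
                    (∀ x → x ≢ e → f x ≡ + 0) → sumℤ (map f xs) ≡ f e
  sumℤ-map-single f (x∉xs ∷ _) (here refl) f≡0 =
    trans (cong (_+_ (f _)) (sumℤ-map-zero f (All.map (λ x≢y → f≡0 _ (x≢y ∘ sym)) x∉xs)))
          (ℤP.+-identityʳ _)
  sumℤ-map-single f (x∉xs ∷ u) (there e∈xs) f≡0 =
    trans (cong₂ _+_ (f≡0 _ (λ { refl → All.lookup x∉xs e∈xs refl })) (sumℤ-map-single f u e∈xs f≡0))
          (ℤP.+-identityˡ _)

  sumℤ-swap : (f : A → B → ℤ) (xs : List A) (ys : List B) →
              sumℤ (map (λ x → sumℤ (map (f x) ys)) xs)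
              ≡ sumℤ (map (λ y → sumℤ (map (λ x → f x y) xs)) ys)
  sumℤ-swap f []       ys = sym (sumℤ-map-zero _ (All.universal (λ _ → refl) ys))
  sumℤ-swap f (x ∷ xs) ys = begin
    sumℤ (map (f x) ys) + sumℤ (map (λ x → sumℤ (map (f x) ys)) xs)
      ≡⟨ cong (_+_ (sumℤ (map (f x) ys))) (sumℤ-swap f xs ys) ⟩
    sumℤ (map (f x) ys) + sumℤ (map (λ y → sumℤ (map (λ x → f x y) xs)) ys)
      ≡⟨ sumℤ-map-+ (f x) (λ y → sumℤ (map (λ x → f x y) xs)) ys ⟨
    sumℤ (map (λ y → f x y + sumℤ (map (λ x → f x y) xs)) ys)
      ∎
    where open ≡-Reasoning

  indicator : {P : Set} → Dec P → ℤ
  indicator (yes _) = + 1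
  indicator (no _)  = + 0

  indicator-yes : {P : Set} (P? : Dec P) → P → indicator P? ≡ + 1
  indicator-yes (yes _) _  = refl
  indicator-yes (no ¬p) p  = contradiction p ¬p

  indicator-no : {P : Set} (P? : Dec P) → ¬ P → indicator P? ≡ + 0
  indicator-no (yes p) ¬p = contradiction p ¬p
  indicator-no (no _)  _  = refl

  indicator-cong : {P Q : Set} (P? : Dec P) (Q? : Dec Q) → P ⇔ Q → indicator P? ≡ indicator Q?
  indicator-cong (yes p) Q? P⇔Q = sym (indicator-yes Q? (Equivalence.to P⇔Q p))
  indicator-cong (no ¬p) Q? P⇔Q = sym (indicator-no Q? (¬p ∘ Equivalence.from P⇔Q))

  length-filter-as-sumℤ : {P : A → Set} (P? : ∀ x → Dec (P x)) (xs : List A) →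
                          + length (filter P? xs) ≡ sumℤ (map (λ x → indicator (P? x)) xs)
  length-filter-as-sumℤ P? []       = refl
  length-filter-as-sumℤ P? (x ∷ xs) with P? x
  ... | yes _ = cong (_+_ (+ 1)) (length-filter-as-sumℤ P? xs)
  ... | no _  = trans (length-filter-as-sumℤ P? xs) (sym (ℤP.+-identityˡ _))

  double-counting : {R : A → B → Set} (R? : ∀ x y → Dec (R x y)) (xs : List A) (ys : List B) →
                    sumℤ (map (λ x → + length (filter (R? x) ys)) xs)
                    ≡ sumℤ (map (λ y → + length (filter (λ x → R? x y) xs)) ys)
  double-counting R? xs ys = begin
    sumℤ (map (λ x → + length (filter (R? x) ys)) xs)
      ≡⟨ cong sumℤ (ListP.map-cong (λ x → length-filter-as-sumℤ (R? x) ys) xs) ⟩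
    sumℤ (map (λ x → sumℤ (map (λ y → indicator (R? x y)) ys)) xs)
      ≡⟨ sumℤ-swap (λ x y → indicator (R? x y)) xs ys ⟩
    sumℤ (map (λ y → sumℤ (map (λ x → indicator (R? x y)) xs)) ys)
      ≡⟨ cong sumℤ (ListP.map-cong (λ y → length-filter-as-sumℤ (λ x → R? x y) xs) ys) ⟨
    sumℤ (map (λ y → + length (filter (λ x → R? x y) xs)) ys)
      ∎
    where open ≡-Reasoning

  length-filter-single : {P : A → Set} (P? : ∀ x → Dec (P x)) {xs : List A} {e : A} →
                         Unique xs → e ∈ xs → (∀ x → P x ⇔ x ≡ e) → + length (filter P? xs) ≡ + 1
  length-filter-single P? {xs} {e} unique e∈xs P⇔≡e = begin
    + length (filter P? xs)                    ≡⟨ length-filter-as-sumℤ P? xs ⟩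
    sumℤ (map (λ x → indicator (P? x)) xs)     ≡⟨ sumℤ-map-single _ unique e∈xs off ⟩
    indicator (P? e)                           ≡⟨ indicator-yes (P? e) (Equivalence.from (P⇔≡e e) refl) ⟩
    + 1                                        ∎
    where
    open ≡-Reasoning
    off : ∀ x → x ≢ e → indicator (P? x) ≡ + 0
    off x x≢e = indicator-no (P? x) (x≢e ∘ Equivalence.to (P⇔≡e x))

module Congruence (K : FiniteField) (p : ℕ) where
  open WithField K p using (_≈ₚ_; sumℤ)
  open import Data.Integer using (_+_; -_; _*_; _-_)
  open +-*-Solver

  -- a ≈ₚ b unfolds to a divisibility statement about a - b, from which a and b cannot be
  -- inferred; the compared terms are therefore explicit arguments.
  private
    variable
      A : Set

    ≈ₚ-by : ∀ a b c → a - b ≡ c → (+ p) ℤ∣.∣ c → a ≈ₚ b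
    ≈ₚ-by a b c eq p∣c = ℤ∣.∣⇒∣ᵤ (subst ((+ p) ℤ∣.∣_) (sym eq) p∣c)

    divides : ∀ a b → a ≈ₚ b → (+ p) ℤ∣.∣ (a - b)
    divides a b = ℤ∣.∣ᵤ⇒∣

  ≈ₚ-isEquivalence : IsEquivalence _≈ₚ_
  ≈ₚ-isEquivalence = record
    { refl  = λ {a} → ≈ₚ-by a a (+ 0) (ℤP.+-inverseʳ a) (ℤ∣.∣ᵤ⇒∣ (p ℕ∣.∣0))
    ; sym   = λ {a} {b} a≈b → ≈ₚ-by b a (- (a - b)) (flip a b) (ℤ∣.∣m⇒∣-m (divides a b a≈b))
    ; trans = λ {a} {b} {c} a≈b b≈c →
        ≈ₚ-by a c ((a - b) + (b - c)) (telescope a b c)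
          (ℤ∣.∣m∣n⇒∣m+n (divides a b a≈b) (divides b c b≈c))
    }
    where
    flip : ∀ a b → b - a ≡ - (a - b)
    flip = solve 2 (λ a b → b :- a := :- (a :- b)) refl
    telescope : ∀ a b c → a - c ≡ (a - b) + (b - c)
    telescope = solve 3 (λ a b c → a :- c := (a :- b) :+ (b :- c)) refl

  ≈ₚ-refl : ∀ a → a ≈ₚ a
  ≈ₚ-refl a = IsEquivalence.refl ≈ₚ-isEquivalence {a}

  ≈ₚ-reflexive : ∀ {a b} → a ≡ b → a ≈ₚ b
  ≈ₚ-reflexive {a} refl = ≈ₚ-refl a

  ≈ₚ-setoid : Setoid _ _
  ≈ₚ-setoid = record { isEquivalence = ≈ₚ-isEquivalence }

  +-cong-≈ₚ : ∀ a b c d → a ≈ₚ b → c ≈ₚ d → a + c ≈ₚ b + d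
  +-cong-≈ₚ a b c d a≈b c≈d =
    ≈ₚ-by (a + c) (b + d) ((a - b) + (c - d)) (medial a b c d)
      (ℤ∣.∣m∣n⇒∣m+n (divides a b a≈b) (divides c d c≈d))
    where
    medial : ∀ a b c d → (a + c) - (b + d) ≡ (a - b) + (c - d)
    medial = solve 4 (λ a b c d → (a :+ c) :- (b :+ d) := (a :- b) :+ (c :- d)) refl

  neg-cong-≈ₚ : ∀ a b → a ≈ₚ b → - a ≈ₚ - b
  neg-cong-≈ₚ a b a≈b = ≈ₚ-by (- a) (- b) (- (a - b)) (neg-sub a b) (ℤ∣.∣m⇒∣-m (divides a b a≈b))
    where
    neg-sub : ∀ a b → - a - - b ≡ - (a - b)
    neg-sub = solve 2 (λ a b → :- a :- :- b := :- (a :- b)) refl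

  *-congʳ-≈ₚ : ∀ a b c → a ≈ₚ b → a * c ≈ₚ b * c
  *-congʳ-≈ₚ a b c a≈b =
    ≈ₚ-by (a * c) (b * c) ((a - b) * c) (distrib a b c) (ℤ∣.∣m⇒∣m*n c (divides a b a≈b))
    where
    distrib : ∀ a b c → a * c - b * c ≡ (a - b) * c
    distrib = solve 3 (λ a b c → a :* c :- b :* c := (a :- b) :* c) refl

  p∣n⇒n≈ₚ0 : ∀ {n} → p ℕ∣.∣ n → + n ≈ₚ + 0
  p∣n⇒n≈ₚ0 {n} p∣n = ≈ₚ-by (+ n) (+ 0) (+ n) (ℤP.+-identityʳ (+ n)) (ℤ∣.∣ᵤ⇒∣ p∣n)

  sumℤ-cong-≈ₚ : (f g : A → ℤ) → (∀ x → f x ≈ₚ g x) → (xs : List A) →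
                 sumℤ (map f xs) ≈ₚ sumℤ (map g xs)
  sumℤ-cong-≈ₚ f g f≈g []       = ≈ₚ-refl (+ 0)
  sumℤ-cong-≈ₚ f g f≈g (x ∷ xs) =
    +-cong-≈ₚ (f x) (g x) (sumℤ (map f xs)) (sumℤ (map g xs)) (f≈g x) (sumℤ-cong-≈ₚ f g f≈g xs)

module Incidence (K : FiniteField) (p : ℕ) where
  open FiniteField K
  open WithField K p
  open FieldProperties K
  open IntegerSums K p using (indicator; indicator-yes; indicator-no)
  open import Algebra.Solver.Ring.NaturalCoefficients.Default
    (CommutativeRing.commutativeSemiring commutativeRing) using (solve; _:=_; _:+_; _:*_; con)

  pointLine : F × F → Triple
  pointLine (x , y) = x , y , 1#

  origin : Triple
  origin = 0# , 0# , 1#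

  infixr 7 _·_
  _·_ : F → Triple → Triple
  t · (x , y , z) = t * x , t * y , t * z

  onLine? : ∀ Q ℓ → Dec (OnLine Q ℓ)
  onLine? (x , y , z) (a , b , c) = (a * x + b * y + c * z) ≟ 0#

  χ≡indicator : ∀ ℓ Q → χ ℓ Q ≡ indicator (onLine? Q ℓ)
  χ≡indicator (a , b , c) (x , y , z) with (a * x + b * y + c * z) ≟ 0#
  ... | yes _ = refl
  ... | no _  = refl

  χ-on : ∀ {Q ℓ} → OnLine Q ℓ → χ ℓ Q ≡ + 1
  χ-on {Q} {ℓ} Q∈ℓ = trans (χ≡indicator ℓ Q) (indicator-yes (onLine? Q ℓ) Q∈ℓ)

  χ-off : ∀ {Q ℓ} → ¬ OnLine Q ℓ → χ ℓ Q ≡ + 0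
  χ-off {Q} {ℓ} Q∉ℓ = trans (χ≡indicator ℓ Q) (indicator-no (onLine? Q ℓ) Q∉ℓ)

  private
    triple-≡ : ∀ {x y z x′ y′ z′ : F} → x ≡ x′ → y ≡ y′ → z ≡ z′ →
               (x , y , z) ≡ (x′ , y′ , z′)
    triple-≡ refl refl refl = refl

    ≡0-subst : ∀ {u v} {P : Set} → u ≡ v → v ≡ 0# ⇔ P → u ≡ 0# ⇔ P
    ≡0-subst refl = id

  OnLine-scale : ∀ {t} → t ≢ 0# → ∀ Q ℓ → OnLine (t · Q) ℓ ⇔ OnLine Q ℓ
  OnLine-scale {t} t≢0 (x , y , z) (a , b , c) =
    ≡0-subst (factor a b c x y z t)
      (mk⇔ (x*y≡0⇒y≡0 t≢0) (λ u≡0 → trans (cong (t *_) u≡0) (zeroʳ t)))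
    where
    factor : ∀ a b c x y z t → a * (t * x) + b * (t * y) + c * (t * z) ≡ t * (a * x + b * y + c * z)
    factor = solve 7 (λ a b c x y z t →
      a :* (t :* x) :+ b :* (t :* y) :+ c :* (t :* z) := t :* (a :* x :+ b :* y :+ c :* z)) refl

  record DualPoint (Q : Triple) (d : Dir) (b : F) : Set where
    field
      onPointLine : ∀ pt → OnLine Q (pointLine pt) ⇔ OnAffLine d b pt
      onLineDir   : ∀ d′ → OnLine Q (lineDir d′) ⇔ d′ ≡ d

  DualPoint-scale : ∀ {t Q d b} → t ≢ 0# → DualPoint Q d b → DualPoint (t · Q) d b
  DualPoint-scale {Q = Q} t≢0 dual = record
    { onPointLine = λ pt → onPointLine pt ⇔-∘ OnLine-scale t≢0 Q (pointLine pt)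
    ; onLineDir   = λ d′ → onLineDir d′ ⇔-∘ OnLine-scale t≢0 Q (lineDir d′)
    }
    where open DualPoint dual

  ptDir-dual : ∀ d b → DualPoint (ptDir d b) d b
  ptDir-dual (just d) b = record { onPointLine = onPointLine ; onLineDir = onLineDir }
    where
    onPointLine : ∀ pt → OnLine (ptDir (just d) b) (pointLine pt) ⇔ OnAffLine (just d) b pt
    onPointLine (x , y) =
      ≡0-subst (trans (form x y d b (- 1#)) (cong (_+_ (d * x + b)) (x*-1≡-x y)))
        (mk⇔ sym sym ⇔-∘ x-y≡0⇔x≡y (d * x + b) y)
      where
      form : ∀ x y d b m → x * d + y * m + 1# * b ≡ d * x + b + y * m
      form = solve 5 (λ x y d b m → x :* d :+ y :* m :+ con 1 :* b := d :* x :+ b :+ y :* m) refl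
    onLineDir : ∀ d′ → OnLine (ptDir (just d) b) (lineDir d′) ⇔ d′ ≡ just d
    onLineDir (just d′) =
      ≡0-subst (trans (form d d′ b (- 1#)) (cong (_+_ d) (x*-1≡-x d′)))
        (mk⇔ (cong just ∘ sym) (sym ∘ MaybeP.just-injective) ⇔-∘ x-y≡0⇔x≡y d d′)
      where
      form : ∀ d d′ b m → 1# * d + d′ * m + 0# * b ≡ d + d′ * m
      form = solve 4 (λ d d′ b m → con 1 :* d :+ d′ :* m :+ con 0 :* b := d :+ d′ :* m) refl
    onLineDir nothing = ≡0-subst (form d b (- 1#)) (⇔-both-false (x≢0⇒-x≢0 1≢0) λ ())
      where
      form : ∀ d b m → 0# * d + 1# * m + 0# * b ≡ m
      form = solve 3 (λ d b m → con 0 :* d :+ con 1 :* m :+ con 0 :* b := m) refl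
  ptDir-dual nothing b = record { onPointLine = onPointLine ; onLineDir = onLineDir }
    where
    onPointLine : ∀ pt → OnLine (ptDir nothing b) (pointLine pt) ⇔ OnAffLine nothing b pt
    onPointLine (x , y) = ≡0-subst (form x y b) (mk⇔ id id)
      where
      form : ∀ x y b → x * 1# + y * 0# + 1# * b ≡ x + b
      form = solve 3 (λ x y b → x :* con 1 :+ y :* con 0 :+ con 1 :* b := x :+ b) refl
    onLineDir : ∀ d′ → OnLine (ptDir nothing b) (lineDir d′) ⇔ d′ ≡ nothing
    onLineDir (just d′) = ≡0-subst (form d′ b) (⇔-both-false 1≢0 λ ())
      where
      form : ∀ d′ b → 1# * 1# + d′ * 0# + 0# * b ≡ 1#
      form = solve 2 (λ d′ b → con 1 :* con 1 :+ d′ :* con 0 :+ con 0 :* b := con 1) refl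
    onLineDir nothing = ⇔-both-true (form b) refl
      where
      form : ∀ b → 0# * 1# + 1# * 0# + 0# * b ≡ 0#
      form = solve 1 (λ b → con 0 :* con 1 :+ con 1 :* con 0 :+ con 0 :* b := con 0) refl

  origin-on-lineDir : ∀ d → OnLine origin (lineDir d)
  origin-on-lineDir (just d) = solve 1 (λ d → con 1 :* con 0 :+ d :* con 0 :+ con 0 :* con 1 := con 0) refl d
  origin-on-lineDir nothing  = solve 0 (con 0 :* con 0 :+ con 1 :* con 0 :+ con 0 :* con 1 := con 0) refl

  origin-off-pointLine : ∀ pt → ¬ OnLine origin (pointLine pt)
  origin-off-pointLine (x , y) = 1≢0 ∘ trans (sym (form x y))
    where
    form : ∀ x y → x * 0# + y * 0# + 1# * 1# ≡ 1#
    form = solve 2 (λ x y → x :* con 0 :+ y :* con 0 :+ con 1 :* con 1 := con 1) refl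

  normalise : ∀ Q → NonZero3 Q →
              (∃ λ t → ∃₂ λ d b → t ≢ 0# × t · ptDir d b ≡ Q)
              ⊎ (∃ λ t → t ≢ 0# × t · origin ≡ Q)
  normalise (x , y , z) Q≢0 with y ≟ 0#
  ... | no y≢0 with inverse (- y) (x≢0⇒-x≢0 y≢0)
  ...   | i , -y*i≡1 = inj₁ (- y , just (i * x) , i * z , x≢0⇒-x≢0 y≢0 ,
      triple-≡ (x*[x⁻¹*y]≡y -y*i≡1 x)
               (trans (x*-1≡-x (- y)) (-‿involutive y))
               (x*[x⁻¹*y]≡y -y*i≡1 z))
  normalise (x , _ , z) Q≢0 | yes refl with x ≟ 0#
  ... | no x≢0 with inverse x x≢0
  ...   | i , x*i≡1 = inj₁ (x , nothing , i * z , x≢0 ,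
      triple-≡ (*-identityʳ x) (zeroʳ x) (x*[x⁻¹*y]≡y x*i≡1 z))
  normalise (_ , _ , z) Q≢0 | yes refl | yes refl with z ≟ 0#
  ... | no z≢0  = inj₂ (z , z≢0 , triple-≡ (zeroʳ z) (zeroʳ z) (*-identityʳ z))
  ... | yes refl = contradiction (refl , refl , refl) Q≢0

  pointLine-nonzero : ∀ pt → NonZero3 (pointLine pt)
  pointLine-nonzero _ (_ , _ , 1≡0) = 1≢0 1≡0

  lineDir-nonzero : ∀ d → NonZero3 (lineDir d)
  lineDir-nonzero (just _) (1≡0 , _)     = 1≢0 1≡0
  lineDir-nonzero nothing  (_ , 1≡0 , _) = 1≢0 1≡0

  ptDir-nonzero : ∀ d b → NonZero3 (ptDir d b)
  ptDir-nonzero (just _) _ (_ , -1≡0 , _) = x≢0⇒-x≢0 1≢0 -1≡0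
  ptDir-nonzero nothing  _ (1≡0 , _)      = 1≢0 1≡0

  origin-nonzero : NonZero3 origin
  origin-nonzero (_ , _ , 1≡0) = 1≢0 1≡0

  ptDir-not-origin : ∀ d b → ¬ SameProj origin (ptDir d b)
  ptDir-not-origin (just _) _ (t , _ , _ , -1≡t0 , _) = x≢0⇒-x≢0 1≢0 (trans -1≡t0 (zeroʳ t))
  ptDir-not-origin nothing  _ (t , _ , 1≡t0 , _)      = 1≢0 (trans 1≡t0 (zeroʳ t))

  allDirs-unique : Unique allDirs
  allDirs-unique = AllP.map⁺ (All.universal (λ _ ()) elems) ∷ UniqueP.map⁺ MaybeP.just-injective elems-unique

  ∈-allDirs : ∀ d → d ∈ allDirs
  ∈-allDirs nothing  = here refl
  ∈-allDirs (just x) = there (∈P.∈-map⁺ just (∈-elems x))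

module Counting (K : FiniteField) (p : ℕ) where
  open FiniteField K using (F; _+_; _*_; -_; _≟_; 0#; elems; size; inverse)
  open FieldProperties K
  open WithField K p
  open IntegerSums K p
  open Congruence K p
  open Incidence K p using (allDirs-unique; ∈-allDirs)

  private
    e*0+0≡0 : ∀ e → e * 0# + 0# ≡ 0#
    e*0+0≡0 e = trans (+-identityʳ (e * 0#)) (zeroʳ e)

  pencil : F × F → ℤ
  pencil pt = + length (filter (λ d → onAffLine? d 0# pt) allDirs)

  pencil-single : ∀ {pt} e → (∀ d → OnAffLine d 0# pt ⇔ d ≡ e) → pencil pt ≡ + 1
  pencil-single {pt} e = length-filter-single (λ d → onAffLine? d 0# pt) allDirs-unique (∈-allDirs e)

  pencil-count : p ℕ∣.∣ size → ∀ pt → pencil pt ≈ₚ + 1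
  pencil-count p∣q (x , y) with x ≟ 0#
  ... | no x≢0 with inverse x x≢0
  ...   | x⁻¹ , x*x⁻¹≡1 = ≈ₚ-reflexive (pencil-single (just (y * x⁻¹)) through)
    where
    through : ∀ d → OnAffLine d 0# (x , y) ⇔ d ≡ just (y * x⁻¹)
    through nothing  = ⇔-both-false (x≢0 ∘ trans (sym (+-identityʳ x))) λ ()
    through (just e) = subst (λ z → y ≡ z ⇔ just e ≡ just (y * x⁻¹)) (sym (+-identityʳ (e * x)))
      (mk⇔ (cong just) MaybeP.just-injective ⇔-∘ y≡e*x⇔e≡y*x⁻¹ x*x⁻¹≡1 y e)
  pencil-count p∣q (_ , y) | yes refl with y ≟ 0#
  ... | no y≢0 = ≈ₚ-reflexive (pencil-single nothing through)
    where
    through : ∀ d → OnAffLine d 0# (0# , y) ⇔ d ≡ nothing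
    through nothing  = ⇔-both-true (+-identityʳ 0#) refl
    through (just e) = ⇔-both-false (y≢0 ∘ λ y≡e0+0 → trans y≡e0+0 (e*0+0≡0 e)) λ ()
  ... | yes refl = begin
    pencil (0# , 0#)  ≡⟨ cong (+_ ∘ length) (ListP.filter-all (λ d → onAffLine? d 0# (0# , 0#)) all-on) ⟩
    + length allDirs  ≡⟨ cong (λ n → + 1 ℤ.+ + n) (trans (ListP.length-map just elems) length-elems) ⟩
    + 1 ℤ.+ + size    ≈⟨ +-cong-≈ₚ (+ 1) (+ 1) (+ size) (+ 0) (≈ₚ-refl (+ 1)) (p∣n⇒n≈ₚ0 p∣q) ⟩
    + 1               ∎
    where
    open SetoidReasoning ≈ₚ-setoid
    on : ∀ d → OnAffLine d 0# (0# , 0#)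
    on nothing  = +-identityʳ 0#
    on (just e) = sym (e*0+0≡0 e)
    all-on : All (λ d → OnAffLine d 0# (0# , 0#)) allDirs
    all-on = All.universal on allDirs

  pencil-sum : p ℕ∣.∣ size → (M : Multiset) → sumℤ (map (λ d → pr M d 0#) allDirs) ≈ₚ + length M
  pencil-sum p∣q M = begin
    sumℤ (map (λ d → pr M d 0#) allDirs)
      ≡⟨ double-counting (λ d → onAffLine? d 0#) allDirs M ⟩
    sumℤ (map pencil M)
      ≈⟨ sumℤ-cong-≈ₚ pencil (λ _ → + 1) (pencil-count p∣q) M ⟩
    sumℤ (map (λ _ → + 1) M)
      ≡⟨ sumℤ-map-const (+ 1) M ⟩
    + length M ℤ.* + 1
      ≡⟨ ℤP.*-identityʳ (+ length M) ⟩
    + length M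
      ∎
    where open SetoidReasoning ≈ₚ-setoid

  vertical-sum : (M : Multiset) → sumℤ (map (λ b → pr M nothing b) elems) ≡ + length M
  vertical-sum M = begin
    sumℤ (map (λ b → pr M nothing b) elems)
      ≡⟨ double-counting (onAffLine? nothing) elems M ⟩
    sumℤ (map (λ pt → + length (filter (λ b → onAffLine? nothing b pt) elems)) M)
      ≡⟨ cong sumℤ (ListP.map-cong vertical-count M) ⟩
    sumℤ (map (λ _ → + 1) M)
      ≡⟨ sumℤ-map-const (+ 1) M ⟩
    + length M ℤ.* + 1
      ≡⟨ ℤP.*-identityʳ (+ length M) ⟩
    + length M
      ∎
    where
    open ≡-Reasoning
    vertical-count : ∀ pt → + length (filter (λ b → onAffLine? nothing b pt) elems) ≡ + 1
    vertical-count (x , y) = length-filter-single _ elems-unique (∈-elems (- x)) (x+y≡0⇔y≡-x x)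

  equidistributed-residues-sum : p ℕ∣.∣ size → (M : Multiset) (r : Dir → ℕ) →
    (∀ d b → pr M d b ≈ₚ + r d) → sumℤ (map (λ d → + r d) allDirs) ≈ₚ + 0
  equidistributed-residues-sum p∣q M r residues = begin
    sumℤ (map (λ d → + r d) allDirs)
      ≈⟨ sumℤ-cong-≈ₚ (λ d → pr M d 0#) (λ d → + r d) (λ d → residues d 0#) allDirs ⟨
    sumℤ (map (λ d → pr M d 0#) allDirs)
      ≈⟨ pencil-sum p∣q M ⟩
    + length M
      ≡⟨ vertical-sum M ⟨
    sumℤ (map (λ b → pr M nothing b) elems)
      ≈⟨ sumℤ-cong-≈ₚ (pr M nothing) (λ _ → + r nothing) (residues nothing) elems ⟩
    sumℤ (map (λ _ → + r nothing) elems)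
      ≡⟨ sumℤ-map-const (+ r nothing) elems ⟩
    + length elems ℤ.* + r nothing
      ≡⟨ cong (λ n → + n ℤ.* + r nothing) length-elems ⟩
    + size ℤ.* + r nothing
      ≈⟨ *-congʳ-≈ₚ (+ size) (+ 0) (+ r nothing) (p∣n⇒n≈ₚ0 p∣q) ⟩
    + 0 ℤ.* + r nothing
      ≡⟨ ℤP.*-zeroˡ (+ r nothing) ⟩
    + 0
      ∎
    where open SetoidReasoning ≈ₚ-setoid

module Codeword
  (K : FiniteField) (p : ℕ)
  (M : WithField.Multiset K p)
  (eq? : ∀ d → Dec (WithField.ModEquidistributed K p M d))
  (r : WithField.Dir K p → ℕ)
  (residues : ∀ d → WithField.ModEquidistributed K p M d →
                    ∀ b → WithField._≈ₚ_ K p (WithField.pr K p M d b) (+ r d))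
  where
  open FiniteField K using (F; 0#; elems; size)
  open WithField K p
  open IntegerSums K p
  open Congruence K p
  open Incidence K p
  open Counting K p
  open import Data.Integer using (_+_; -_; _*_; _-_)

  residue : (d : Dir) → Dec (ModEquidistributed M d) → ℤ
  residue d (yes _) = + r d
  residue d (no _)  = + 0

  residue-equidistributed : ∀ {d} (d? : Dec (ModEquidistributed M d)) → ModEquidistributed M d →
                            residue d d? ≡ + r d
  residue-equidistributed (yes _)      _    = refl
  residue-equidistributed (no special) equi = contradiction equi special

  residue-special : ∀ {d} (d? : Dec (ModEquidistributed M d)) → ModSpecial M d → residue d d? ≡ + 0
  residue-special (yes equi) special = contradiction equi special
  residue-special (no _)     _       = refl

  incidences : Triple → ℤ
  incidences P = sumℤ (map (λ pt → χ (pointLine pt) P) M)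

  linePart : Triple → Dir → ℤ
  linePart P d = residue d (eq? d) * χ (lineDir d) P

  -- The summand of cM over directions is a where-bound function of Defs, which cannot be named.
  -- directionTerm names it: its body is solved by unification in cM-unfold, where the summand at
  -- nothing is split off first so that the unifier only meets directionTerm applied to variables.
  mutual
    directionTerm : Triple → Dir → ℤ
    directionTerm = _

    cM-unfold : ∀ P → cM M eq? r P
                      ≡ incidences P - (linePart P nothing + sumℤ (map (directionTerm P) (map just elems)))
    cM-unfold P with eq? nothing
    ... | yes _ = refl
    ... | no _  = refl

  directionTerm≡linePart : ∀ P d → directionTerm P d ≡ linePart P d
  directionTerm≡linePart P d with eq? d
  ... | yes _ = refl
  ... | no _  = refl

  cM-expansion : ∀ P → cM M eq? r P ≡ incidences P - sumℤ (map (linePart P) allDirs)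
  cM-expansion P = trans (cM-unfold P)
    (cong (λ s → incidences P - (linePart P nothing + sumℤ s))
          (ListP.map-cong (directionTerm≡linePart P) (map just elems)))

  linePart-on : ∀ {Q d} → OnLine Q (lineDir d) → linePart Q d ≡ residue d (eq? d)
  linePart-on {Q} {d} Q∈ℓ =
    trans (cong (_*_ (residue d (eq? d))) (χ-on Q∈ℓ)) (ℤP.*-identityʳ (residue d (eq? d)))

  linePart-off : ∀ {Q d} → ¬ OnLine Q (lineDir d) → linePart Q d ≡ + 0
  linePart-off {Q} {d} Q∉ℓ =
    trans (cong (_*_ (residue d (eq? d))) (χ-off Q∉ℓ)) (ℤP.*-zeroʳ (residue d (eq? d)))

  incidences-dual : ∀ {Q d b} → DualPoint Q d b → incidences Q ≡ pr M d b
  incidences-dual {Q} {d} {b} dual = begin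
    sumℤ (map (λ pt → χ (pointLine pt) Q) M)
      ≡⟨ cong sumℤ (ListP.map-cong incidence M) ⟩
    sumℤ (map (λ pt → indicator (onAffLine? d b pt)) M)
      ≡⟨ length-filter-as-sumℤ (onAffLine? d b) M ⟨
    pr M d b
      ∎
    where
    open ≡-Reasoning
    incidence : ∀ pt → χ (pointLine pt) Q ≡ indicator (onAffLine? d b pt)
    incidence pt = trans (χ≡indicator (pointLine pt) Q) (indicator-cong _ _ (DualPoint.onPointLine dual pt))

  sum-lineParts-dual : ∀ {Q d b} → DualPoint Q d b → sumℤ (map (linePart Q) allDirs) ≡ residue d (eq? d)
  sum-lineParts-dual {Q} {d} dual =
    trans (sumℤ-map-single (linePart Q) allDirs-unique (∈-allDirs d) off)
          (linePart-on (from (onLineDir d) refl))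
    where
    open DualPoint dual
    open Equivalence
    off : ∀ d′ → d′ ≢ d → linePart Q d′ ≡ + 0
    off d′ d′≢d = linePart-off (d′≢d ∘ to (onLineDir d′))

  cM-dual : ∀ {Q d b} → DualPoint Q d b → cM M eq? r Q ≡ pr M d b - residue d (eq? d)
  cM-dual {Q} dual = trans (cM-expansion Q) (cong₂ _-_ (incidences-dual dual) (sum-lineParts-dual dual))

  cM-dual-special : ∀ {Q d b} → DualPoint Q d b → ModSpecial M d → cM M eq? r Q ≡ pr M d b
  cM-dual-special {d = d} {b} dual special =
    trans (cM-dual dual)
          (trans (cong (_-_ (pr M d b)) (residue-special (eq? d) special)) (ℤP.+-identityʳ (pr M d b)))

  cM-dual-equidistributed : ∀ {Q d b} → DualPoint Q d b → ModEquidistributed M d → cM M eq? r Q ≈ₚ + 0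
  cM-dual-equidistributed {Q} {d} {b} dual equi = begin
    cM M eq? r Q                 ≡⟨ cM-dual dual ⟩
    pr M d b - residue d (eq? d) ≡⟨ cong (_-_ (pr M d b)) (residue-equidistributed (eq? d) equi) ⟩
    pr M d b - + r d             ≈⟨ +-cong-≈ₚ (pr M d b) (+ r d) (- + r d) (- + r d)
                                      (residues d equi b) (≈ₚ-refl (- + r d)) ⟩
    + r d - + r d                ≡⟨ ℤP.+-inverseʳ (+ r d) ⟩
    + 0                          ∎
    where
    open SetoidReasoning ≈ₚ-setoid

  cM-origin : p ℕ∣.∣ size → ∀ {t} → t ≢ 0# → (∀ d → ModEquidistributed M d) →
              cM M eq? r (t · origin) ≈ₚ + 0
  cM-origin p∣q {t} t≢0 all-equi = begin
    cM M eq? r (t · origin)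
      ≡⟨ cM-expansion (t · origin) ⟩
    incidences (t · origin) - sumℤ (map (linePart (t · origin)) allDirs)
      ≡⟨ cong₂ _-_ no-incidences (cong sumℤ (ListP.map-cong on-all-lines allDirs)) ⟩
    + 0 - Σr
      ≡⟨ ℤP.+-identityˡ (- Σr) ⟩
    - Σr
      ≈⟨ neg-cong-≈ₚ Σr (+ 0) (equidistributed-residues-sum p∣q M r (λ d → residues d (all-equi d))) ⟩
    + 0
      ∎
    where
    open SetoidReasoning ≈ₚ-setoid
    Σr : ℤ
    Σr = sumℤ (map (λ d → + r d) allDirs)
    no-incidences : incidences (t · origin) ≡ + 0
    no-incidences = sumℤ-map-zero _ (All.universal off M)
      where
      off : ∀ pt → χ (pointLine pt) (t · origin) ≡ + 0
      off pt = χ-off (origin-off-pointLine pt ∘ Equivalence.to (OnLine-scale t≢0 origin (pointLine pt)))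
    on-all-lines : ∀ d → linePart (t · origin) d ≡ + r d
    on-all-lines d =
      trans (linePart-on (Equivalence.from (OnLine-scale t≢0 origin (lineDir d)) (origin-on-lineDir d)))
            (residue-equidistributed (eq? d) (all-equi d))

  cM-at-ptDir : ∀ d b → (ModSpecial M d → cM M eq? r (ptDir d b) ≈ₚ pr M d b)
                      × (¬ ModSpecial M d → cM M eq? r (ptDir d b) ≈ₚ + 0)
  cM-at-ptDir d b =
      (λ special → ≈ₚ-reflexive (cM-dual-special (ptDir-dual d b) special))
    , (λ ¬special → cM-dual-equidistributed (ptDir-dual d b) (decidable-stable (eq? d) ¬special))

  pointTerm : F × F → ℤ × Triple
  pointTerm pt = + 1 , pointLine pt

  lineTerm : Dir → ℤ × Triple
  lineTerm d = - residue d (eq? d) , lineDir d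

  coefficients : List (ℤ × Triple)
  coefficients = map pointTerm M ++ map lineTerm allDirs

  cM-combination : ∀ P →
    cM M eq? r P ≡ sumℤ (map (λ (c : ℤ × Triple) → proj₁ c * χ (proj₂ c) P) coefficients)
  cM-combination P = begin
    cM M eq? r P
      ≡⟨ cM-expansion P ⟩
    incidences P - sumℤ (map (linePart P) allDirs)
      ≡⟨ cong₂ _+_ points lines ⟩
    sumℤ (map evaluate (map pointTerm M)) + sumℤ (map evaluate (map lineTerm allDirs))
      ≡⟨ sumℤ-++ (map evaluate (map pointTerm M)) (map evaluate (map lineTerm allDirs)) ⟨
    sumℤ (map evaluate (map pointTerm M) ++ map evaluate (map lineTerm allDirs))
      ≡⟨ cong sumℤ (ListP.map-++ evaluate (map pointTerm M) (map lineTerm allDirs)) ⟨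
    sumℤ (map evaluate coefficients)
      ∎
    where
    open ≡-Reasoning
    evaluate : ℤ × Triple → ℤ
    evaluate (c , ℓ) = c * χ ℓ P
    points : incidences P ≡ sumℤ (map evaluate (map pointTerm M))
    points = cong sumℤ (trans (ListP.map-cong (λ pt → sym (ℤP.*-identityˡ (χ (pointLine pt) P))) M)
                              (ListP.map-∘ {g = evaluate} {f = pointTerm} M))
    lines : - sumℤ (map (linePart P) allDirs) ≡ sumℤ (map evaluate (map lineTerm allDirs))
    lines = trans (sym (sumℤ-map-neg (linePart P) allDirs))
      (cong sumℤ (trans (ListP.map-cong (λ d → ℤP.neg-distribˡ-* (residue d (eq? d)) (χ (lineDir d) P)) allDirs)
                        (ListP.map-∘ {g = evaluate} {f = lineTerm} allDirs)))

  cM-InCode : InCode (cM M eq? r)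
  cM-InCode = coefficients
            , AllP.++⁺ (AllP.map⁺ (All.universal pointLine-nonzero M))
                       (AllP.map⁺ (All.universal lineDir-nonzero allDirs))
            , λ P _ → ≈ₚ-reflexive (cM-combination P)

  ∈-specialDirs : ∀ {d} → ModSpecial M d → d ∈ specialDirs M eq?
  ∈-specialDirs {d} = ∈P.∈-filter⁺ (λ d → ¬? (eq? d)) (∈-allDirs d)

  on-special-line : ∀ {Q d} → ModSpecial M d → OnLine Q (lineDir d) →
                    Any (OnLine Q) (map lineDir (specialDirs M eq?))
  on-special-line special Q∈ℓ = AnyP.map⁺ (Any.map (λ { refl → Q∈ℓ }) (∈-specialDirs special))

  all-equidistributed : specialDirs M eq? ≡ [] → ∀ d → ModEquidistributed M d
  all-equidistributed none d =
    decidable-stable (eq? d) (λ special → case subst (d ∈_) none (∈-specialDirs special) of λ ())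

  dual-support : ∀ {Q d b} → DualPoint Q d b → ¬ (cM M eq? r Q ≈ₚ + 0) →
                 Any (OnLine Q) (map lineDir (specialDirs M eq?))
  dual-support {d = d} dual c≉0 with eq? d
  ... | yes equi   = contradiction (cM-dual-equidistributed dual equi) c≉0
  ... | no special = on-special-line special (Equivalence.from (DualPoint.onLineDir dual d) refl)

  origin-support : p ℕ∣.∣ size → ∀ {t} → t ≢ 0# → ¬ (cM M eq? r (t · origin) ≈ₚ + 0) →
                   Any (OnLine (t · origin)) (map lineDir (specialDirs M eq?))
  origin-support p∣q t≢0 c≉0 with specialDirs M eq? in none
  ... | d ∷ _ = here (Equivalence.from (OnLine-scale t≢0 origin (lineDir d)) (origin-on-lineDir d))
  ... | []    = contradiction (cM-origin p∣q t≢0 (all-equidistributed none)) c≉0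

  support : p ℕ∣.∣ size → ∀ Q → NonZero3 Q → ¬ (cM M eq? r Q ≈ₚ + 0) →
            Any (OnLine Q) (map lineDir (specialDirs M eq?))
  support p∣q Q Q≢0 c≉0 with normalise Q Q≢0
  ... | inj₁ (t , d , b , t≢0 , refl) = dual-support (DualPoint-scale t≢0 (ptDir-dual d b)) c≉0
  ... | inj₂ (t , t≢0 , refl)         = origin-support p∣q t≢0 c≉0

  special-line-not-constant : ∀ {d} → ModSpecial M d → ¬ ConstantOffP (cM M eq? r) origin (lineDir d)
  special-line-not-constant {d} special (k , constant) = special λ b b′ → begin
    pr M d b                   ≡⟨ cM-dual-special (ptDir-dual d b) special ⟨
    cM M eq? r (ptDir d b)     ≈⟨ value b ⟩
    k                          ≈⟨ value b′ ⟨
    cM M eq? r (ptDir d b′)    ≡⟨ cM-dual-special (ptDir-dual d b′) special ⟩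
    pr M d b′                  ∎
    where
    open SetoidReasoning ≈ₚ-setoid
    value : ∀ b → cM M eq? r (ptDir d b) ≈ₚ k
    value b = constant (ptDir d b) (ptDir-nonzero d b)
                (Equivalence.from (DualPoint.onLineDir (ptDir-dual d b) d) refl) (ptDir-not-origin d b)

  oddCodeword : p ℕ∣.∣ size → OddCodewordOn (cM M eq? r) origin (map lineDir (specialDirs M eq?))
  oddCodeword p∣q = cM-InCode , origin-nonzero
    , AllP.map⁺ (All.universal (λ d → lineDir-nonzero d , origin-on-lineDir d) (specialDirs M eq?))
    , support p∣q
    , AllP.map⁺ (All.map special-line-not-constant (AllP.all-filter (λ d → ¬? (eq? d)) allDirs))

proposition1p20 :
    (K : FiniteField) (p h : ℕ) → Prime p →
    FiniteField.size K ≡ p ^ h →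
    FiniteField.fromℕ K p ≡ FiniteField.0# K →
    let open FiniteField K
        open WithField K p in
    (M : Multiset) →
    (eq? : (d : Dir) → Dec (ModEquidistributed M d)) →
    (r : Dir → ℕ) →
    (∀ d → ModEquidistributed M d → r d < p × (∀ b → pr M d b ≈ₚ + r d)) →
    (∀ d b → (ModSpecial M d → cM M eq? r (ptDir d b) ≈ₚ pr M d b)
           × (¬ ModSpecial M d → cM M eq? r (ptDir d b) ≈ₚ + 0))
    × OddCodewordOn (cM M eq? r) (0# , 0# , 1#) (map lineDir (specialDirs M eq?))
proposition1p20 K p h _ size≡p^h _ M eq? r residues =
  cM-at-ptDir , oddCodeword (size≡p^h⇒p∣size p h size≡p^h)
  where
  open FieldProperties K using (size≡p^h⇒p∣size)
  open Codeword K p M eq? r (λ d equi → proj₂ (residues d equi))
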